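{- Let $\mathcal V=(d,Q,T)$ be an affine $\mathbb Z$-VASS in which every transition is either of the form $(p,I,\mathbf b,q)$ with $\mathbf b\in\mathbb Z^d$ (these form $T_I$), or of the form $(p,J_d,\mathbf 0,q)$ (these form $T_J$), and let $\mathcal W=(Q,\overline T)$ be the affine one-counter $\mathbb Z$-net with $\overline T=\{\overline t:t\in T\}$, where $\overline t=(p,+,\delta(\mathbf b),q)$ if $t=(p,I,\mathbf b,q)\in T_I$ and $\overline t=(p,\cdot,d,q)$ if $t=(p,J_d,\mathbf 0,q)\in T_J$. Then for every $p,q\in Q$, $\mathbf u\in\mathbb Z^d$, $m\in\mathbb Z$ and $w\in T^*$, we have $p(\delta(\mathbf u))\xrightarrow{\overline w}q(m)$ in $\mathcal W$ if and only if $p(\mathbf u)\xrightarrow{w}q(\mathbf v)$ in $\mathcal V$ for some $\mathbf v\in\mathbb Z^d$ with $\delta(\mathbf v)=m$.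
   Context: $J_d\in\mathbb N^{d\times d}$ is the all-ones matrix and $I$ the identity. For $\mathbf v\in\mathbb Z^d$, $\delta(\mathbf v)=\sum_{i=1}^d\mathbf v(i)$. An affine $\mathbb Z$-VASS is $\mathcal V=(d,Q,T)$ with $Q$ finite and $T\subseteq Q\times\mathbb Z^{d\times d}\times\mathbb Z^d\times Q$ finite; configurations are $q(\mathbf v)\in Q\times\mathbb Z^d$; $p(\mathbf u)\xrightarrow{t}q(\mathbf v)$ iff $t=(p,A,\mathbf b,q)$ and $\mathbf v=A\mathbf u+\mathbf b$; for $w=w_1\cdots w_k\in T^*$, $\xrightarrow{w}$ is the composition $\xrightarrow{w_1}\circ\cdots\circ\xrightarrow{w_k}$ (the identity if $k=0$). An affine one-counter $\mathbb Z$-net is a pair $(P,U)$ with $P$ a finite set of states and $U\subseteq P\times\{+,\cdot\}\times\mathbb Z\times P$ a finite set of transitions; its configurations are $q(n)\in P\times\mathbb Z$, and for $t=(p,\circledast,c,q)$, $p(n)\xrightarrow{t}q(m)$ iff $m=n\circledast c$ (i.e. $m=n+c$ or $m=n\cdot c$); runs $\xrightarrow{w}$ along words are defined as for affine $\mathbb Z$-VASS. For $w=w_1\cdots w_k\in T^*$, $\overline w=\overline{w_1}\cdots\overline{w_k}$. -}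

module Defs where

open import Data.Nat using (ℕ)
open import Data.Integer using (ℤ; +_; _+_; _*_; 0ℤ; 1ℤ)
open import Data.Fin using (Fin; _≟_)
open import Data.List using (List; []; _∷_; foldr; map; allFin)
open import Data.List.Membership.Propositional using (_∈_)
open import Data.Product using (_×_; _,_)
open import Data.Sum using (_⊎_; inj₁; inj₂)
open import Relation.Nullary using (yes; no)
open import Relation.Binary.PropositionalEquality using (_≡_; refl)
open import Data.List.Relation.Unary.Any using (here; there)

Vecℤ : ℕ → Set
Vecℤ d = Fin d → ℤ

Mat : ℕ → Set
Mat d = Fin d → Fin d → ℤ

δ : {d : ℕ} → Vecℤ d → ℤ
δ {d} v = foldr _+_ 0ℤ (map v (allFin d))

Id : (d : ℕ) → Mat d
Id d i j with i ≟ j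
... | yes _ = 1ℤ
... | no  _ = 0ℤ

Jmat : (d : ℕ) → Mat d
Jmat d i j = 1ℤ

zeroVec : (d : ℕ) → Vecℤ d
zeroVec d i = 0ℤ

_·ᵥ_ : {d : ℕ} → Mat d → Vecℤ d → Vecℤ d
_·ᵥ_ {d} A u i = foldr _+_ 0ℤ (map (λ j → A i j * u j) (allFin d))

record Trans (d nQ : ℕ) : Set where
  constructor trans
  field
    src : Fin nQ
    mat : Mat d
    vec : Vecℤ d
    tgt : Fin nQ
open Trans public

record AffineZVASS : Set where
  field
    dim    : ℕ
    nQ     : ℕ
    T      : List (Trans dim nQ)
open AffineZVASS public

Step : {d nQ : ℕ} → Fin nQ → Vecℤ d → Trans d nQ → Fin nQ → Vecℤ d → Set
Step p u t q v =
  (src t ≡ p) × (tgt t ≡ q) × (∀ i → v i ≡ (mat t ·ᵥ u) i + vec t i)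

data Run {d nQ : ℕ} : Fin nQ → Vecℤ d → List (Trans d nQ) → Fin nQ → Vecℤ d → Set where
  done : ∀ {p u} → Run p u [] p u
  step : ∀ {p u t w r x q v} → Step p u t r x → Run r x w q v → Run p u (t ∷ w) q v

data Op : Set where
  plus times : Op

record CTrans (nP : ℕ) : Set where
  constructor ctrans
  field
    csrc : Fin nP
    cop  : Op
    cconst : ℤ
    ctgt : Fin nP
open CTrans public

record AffineOCNet : Set where
  field
    nP : ℕ
    U  : List (CTrans nP)
open AffineOCNet public

apply : Op → ℤ → ℤ → ℤ
apply plus  n c = n + c
apply times n c = n * c

CStep : {nP : ℕ} → Fin nP → ℤ → CTrans nP → Fin nP → ℤ → Set
CStep p n t q m = (csrc t ≡ p) × (ctgt t ≡ q) × (m ≡ apply (cop t) n (cconst t))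

data CRun {nP : ℕ} : Fin nP → ℤ → List (CTrans nP) → Fin nP → ℤ → Set where
  done : ∀ {p n} → CRun p n [] p n
  step : ∀ {p n t w r k q m} → CStep p n t r k → CRun r k w q m → CRun p n (t ∷ w) q m

IsTI : {d nQ : ℕ} → Trans d nQ → Set
IsTI {d} t = ∀ i j → mat t i j ≡ Id d i j

IsTJ : {d nQ : ℕ} → Trans d nQ → Set
IsTJ {d} t = (∀ i j → mat t i j ≡ Jmat d i j) × (∀ i → vec t i ≡ 0ℤ)

-- t̄ : (p,+,δ(b),q) for T_I, (p,·,d,q) for T_J.  Defined relative to a
-- chosen classification (for d = 1 both readings coincide semantically,
-- for d ≠ 1 the classification is unique).
bar : {d nQ : ℕ} (t : Trans d nQ) → IsTI t ⊎ IsTJ t → CTrans nQ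
bar t (inj₁ _) = ctrans (src t) plus  (δ (vec t)) (tgt t)
bar {d} t (inj₂ _) = ctrans (src t) times (+ d) (tgt t)

barWord : {d nQ : ℕ} {T : List (Trans d nQ)} →
          (cls : ∀ t → t ∈ T → IsTI t ⊎ IsTJ t) →
          (w : List (Trans d nQ)) → (∀ t → t ∈ w → t ∈ T) → List (CTrans nQ)
barWord cls [] _ = []
barWord cls (t ∷ w) sub =
  bar t (cls t (sub t (here refl)))
  ∷ barWord cls w (λ s s∈w → sub s (there s∈w))

-- Both T_I and T_J transitions act on δ in a way that depends only on δ:
-- adding b adds δ(b), and multiplying by J_d replaces every entry by δ(u),
-- so that δ(J_d u) = d·δ(u).  Hence δ maps each step of 𝒱 to the step of 𝒲
-- along the barred transition; conversely, since steps of 𝒱 are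
-- deterministic, every run of 𝒲 from δ(u) lifts to the unique run of 𝒱 from u.
module Submission where

open import Defs
open import Data.Nat using (ℕ; zero; suc)
open import Data.Integer using (ℤ; +_; _+_; _*_; 0ℤ; 1ℤ)
open import Data.Integer.Properties
  using (+-0-commutativeMonoid; +-identityʳ; *-identityˡ; *-zeroʳ; *-suc)
open import Data.Fin using (Fin; zero; suc; _≟_)
open import Data.Fin.Properties using (punchInᵢ≢i)
open import Data.List using (List; []; _∷_; foldr; tabulate)
open import Data.List.Properties using (map-tabulate)
open import Data.List.Membership.Propositional using (_∈_)
open import Data.List.Relation.Unary.Any using (here; there)
open import Data.Product using (Σ; _×_; _,_)
open import Data.Sum using (_⊎_; inj₁; inj₂)
open import Data.Vec.Functional using (removeAt)
open import Function using (id; _∘_)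
open import Function.Bundles using (_⇔_; mk⇔)
open import Relation.Nullary using (yes; no; contradiction)
open import Relation.Binary.PropositionalEquality
  renaming (trans to ≡-trans)
  using (_≡_; _≢_; _≗_; refl; sym; cong; cong₂; subst; module ≡-Reasoning)
open import Algebra.Properties.CommutativeMonoid.Sum +-0-commutativeMonoid
  using (sum; sum-cong-≗; ∑-distrib-+; sum-remove; sum-replicate-zero)

open ≡-Reasoning

δ≡sum : ∀ {d} (v : Vecℤ d) → δ v ≡ sum v
δ≡sum v = ≡-trans (cong (foldr _+_ 0ℤ) (map-tabulate id v)) (foldr-tabulate v)
  where
  foldr-tabulate : ∀ {n} (f : Vecℤ n) → foldr _+_ 0ℤ (tabulate f) ≡ sum f
  foldr-tabulate {zero}  f = refl
  foldr-tabulate {suc n} f = cong (λ s → f zero + s) (foldr-tabulate (f ∘ suc))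

δ-cong : ∀ {d} {u v : Vecℤ d} → u ≗ v → δ u ≡ δ v
δ-cong {u = u} {v} u≗v = begin
  δ u   ≡⟨ δ≡sum u ⟩
  sum u ≡⟨ sum-cong-≗ u≗v ⟩
  sum v ≡⟨ δ≡sum v ⟨
  δ v   ∎

δ-+ : ∀ {d} (u v : Vecℤ d) → δ (λ i → u i + v i) ≡ δ u + δ v
δ-+ {d} u v = begin
  δ (λ i → u i + v i)   ≡⟨ δ≡sum {d} _ ⟩
  sum (λ i → u i + v i) ≡⟨ ∑-distrib-+ u v ⟩
  sum u + sum v         ≡⟨ cong₂ _+_ (δ≡sum u) (δ≡sum v) ⟨
  δ u + δ v             ∎

δ-const : ∀ d (c : ℤ) → δ {d} (λ _ → c) ≡ c * + d
δ-const d c = ≡-trans (δ≡sum {d} _) (sum-const d)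
  where
  sum-const : ∀ n → sum {n} (λ _ → c) ≡ c * + n
  sum-const zero    = sym (*-zeroʳ c)
  sum-const (suc n) = ≡-trans (cong (λ s → c + s) (sum-const n)) (sym (*-suc c (+ n)))

δ-single : ∀ {d} (v : Vecℤ d) (i : Fin d) → (∀ j → j ≢ i → v j ≡ 0ℤ) → δ v ≡ v i
δ-single {suc d} v i off = begin
  δ v                      ≡⟨ δ≡sum v ⟩
  sum v                    ≡⟨ sum-remove v ⟩
  v i + sum (removeAt v i) ≡⟨ cong (λ s → v i + s) (sum-cong-≗ (λ j → off _ (punchInᵢ≢i i j))) ⟩
  v i + sum {d} (λ _ → 0ℤ) ≡⟨ cong (λ s → v i + s) (sum-replicate-zero d) ⟩
  v i + 0ℤ                 ≡⟨ +-identityʳ (v i) ⟩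
  v i                      ∎

Id-diag : ∀ d (i : Fin d) → Id d i i ≡ 1ℤ
Id-diag d i with i ≟ i
... | yes _   = refl
... | no i≢i = contradiction refl i≢i

Id-off : ∀ d (i j : Fin d) → j ≢ i → Id d i j ≡ 0ℤ
Id-off d i j j≢i with i ≟ j
... | yes i≡j = contradiction (sym i≡j) j≢i
... | no _    = refl

-- (A ·ᵥ u) i unfolds to δ (λ j → A i j * u j), so the δ lemmas apply to rows.
·ᵥ-congˡ : ∀ {d} {A B : Mat d} → (∀ i j → A i j ≡ B i j) → ∀ u i → (A ·ᵥ u) i ≡ (B ·ᵥ u) i
·ᵥ-congˡ A≈B u i = δ-cong (λ j → cong (_* u j) (A≈B i j))

Id-·ᵥ : ∀ {d} (u : Vecℤ d) i → (Id d ·ᵥ u) i ≡ u i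
Id-·ᵥ {d} u i = begin
  (Id d ·ᵥ u) i  ≡⟨ δ-single (λ j → Id d i j * u j) i (λ j j≢i → cong (_* u j) (Id-off d i j j≢i)) ⟩
  Id d i i * u i ≡⟨ cong (_* u i) (Id-diag d i) ⟩
  1ℤ * u i       ≡⟨ *-identityˡ (u i) ⟩
  u i            ∎

Jmat-·ᵥ : ∀ {d} (u : Vecℤ d) i → (Jmat d ·ᵥ u) i ≡ δ u
Jmat-·ᵥ u i = δ-cong (λ j → *-identityˡ (u j))

update : ∀ {d nQ} → Trans d nQ → Vecℤ d → Vecℤ d
update t u i = (mat t ·ᵥ u) i + vec t i

δ-update-TI : ∀ {d nQ} (t : Trans d nQ) (u : Vecℤ d) → IsTI t → δ (update t u) ≡ δ u + δ (vec t)
δ-update-TI t u t∈TI = ≡-trans (δ-cong update≗u+b) (δ-+ u (vec t))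
  where
  update≗u+b : ∀ i → update t u i ≡ u i + vec t i
  update≗u+b i = cong (_+ vec t i) (≡-trans (·ᵥ-congˡ t∈TI u i) (Id-·ᵥ u i))

δ-update-TJ : ∀ {d nQ} (t : Trans d nQ) (u : Vecℤ d) → IsTJ t → δ (update t u) ≡ δ u * + d
δ-update-TJ {d} t u (A≈J , b≈0) = ≡-trans (δ-cong update≗δu) (δ-const d (δ u))
  where
  update≗δu : ∀ i → update t u i ≡ δ u
  update≗δu i = begin
    (mat t ·ᵥ u) i + vec t i   ≡⟨ cong (λ b → (mat t ·ᵥ u) i + b) (b≈0 i) ⟩
    (mat t ·ᵥ u) i + 0ℤ        ≡⟨ +-identityʳ _ ⟩
    (mat t ·ᵥ u) i             ≡⟨ ·ᵥ-congˡ A≈J u i ⟩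
    (Jmat d ·ᵥ u) i            ≡⟨ Jmat-·ᵥ u i ⟩
    δ u                        ∎

module _ {d nQ : ℕ} {t : Trans d nQ} {p q : Fin nQ} {u : Vecℤ d} where

  step⇒barStep : ∀ {v} (c : IsTI t ⊎ IsTJ t) → Step p u t q v → CStep p (δ u) (bar t c) q (δ v)
  step⇒barStep (inj₁ t∈TI) (s , g , v≗) = s , g , ≡-trans (δ-cong v≗) (δ-update-TI t u t∈TI)
  step⇒barStep (inj₂ t∈TJ) (s , g , v≗) = s , g , ≡-trans (δ-cong v≗) (δ-update-TJ t u t∈TJ)

  barStep⇒step : ∀ {m} (c : IsTI t ⊎ IsTJ t) → CStep p (δ u) (bar t c) q m →
                 Step p u t q (update t u) × δ (update t u) ≡ m
  barStep⇒step (inj₁ t∈TI) (s , g , m≡) = (s , g , λ _ → refl) , ≡-trans (δ-update-TI t u t∈TI) (sym m≡)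
  barStep⇒step (inj₂ t∈TJ) (s , g , m≡) = (s , g , λ _ → refl) , ≡-trans (δ-update-TJ t u t∈TJ) (sym m≡)

module _ {d nQ : ℕ} {T : List (Trans d nQ)} (cls : ∀ t → t ∈ T → IsTI t ⊎ IsTJ t) where

  run⇒barRun : ∀ {p q u v} w (w⊆T : ∀ t → t ∈ w → t ∈ T) →
               Run p u w q v → CRun p (δ u) (barWord cls w w⊆T) q (δ v)
  run⇒barRun []      w⊆T done       = done
  run⇒barRun (t ∷ w) w⊆T (step s r) =
    step (step⇒barStep (cls t (w⊆T t (here refl))) s) (run⇒barRun w (λ t′ → w⊆T t′ ∘ there) r)

  barRun⇒run : ∀ {p q u m} w (w⊆T : ∀ t → t ∈ w → t ∈ T) →
               CRun p (δ u) (barWord cls w w⊆T) q m → Σ (Vecℤ d) (λ v → Run p u w q v × δ v ≡ m)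
  barRun⇒run {u = u} []      w⊆T done       = u , done , refl
  barRun⇒run         (t ∷ w) w⊆T (step s r) =
    let s′ , δu′≡k    = barStep⇒step (cls t (w⊆T t (here refl))) s
        v , r′ , δv≡m = barRun⇒run w (λ t′ → w⊆T t′ ∘ there) (subst (λ k → CRun _ k _ _ _) (sym δu′≡k) r)
    in v , step s′ r′ , δv≡m

lemma7p3 : (V : AffineZVASS) →
    (cls : ∀ t → t ∈ T V → IsTI t ⊎ IsTJ t) →
    (p q : Fin (nQ V)) (u : Vecℤ (dim V)) (m : ℤ)
    (w : List (Trans (dim V) (nQ V))) (w∈T* : ∀ t → t ∈ w → t ∈ T V) →
    CRun p (δ u) (barWord cls w w∈T*) q m
      ⇔ Σ (Vecℤ (dim V)) (λ v → Run p u w q v × δ v ≡ m)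
lemma7p3 V cls p q u m w w∈T* = mk⇔ (barRun⇒run cls w w∈T*) lift
  where
  lift : Σ (Vecℤ (dim V)) (λ v → Run p u w q v × δ v ≡ m) → CRun p (δ u) (barWord cls w w∈T*) q m
  lift (v , r , refl) = run⇒barRun cls w w∈T* r
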